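{- There is a regular language $L$ over some alphabet $\Sigma$ and a replacement query $\rho$ such that $(q_L,\Delta_\Sigma)$ can be maintained in $\mathrm{DynFO}$ with nullary auxiliary relations, but $(q_L,\Delta_\Sigma\cup\{\rho\})$ cannot be maintained in $\mathrm{DynFO}$ with nullary auxiliary relations.
   Context: Strings over a finite alphabet $\Sigma$ are represented by databases with domain $\{1,\dots,n\}$, the natural linear order $<$, constants $\min=1$, $\max=n$, and one unary relation $R_\sigma$ per $\sigma\in\Sigma$, each position being in at most one $R_\sigma$; position $i$ carries $\sigma$ if $i\in R_\sigma$ and $\epsilon$ otherwise, and the database represents the concatenation $w_1\cdots w_n$. The order, $\min$, $\max$ are never modified. $q_L$ is the Boolean query whether the represented string belongs to $L$. A replacement query $\rho(\bar p)$ is a set of rules $R_\sigma:=\mu_\sigma(\bar p;x)$ (first-order formulas, distinct $R_\sigma$, common parameters $\bar p$); a change $\rho(\bar a)$ replaces each such $R_\sigma$ by $\{b\mid\mathcal D\models\mu_\sigma(\bar a;b)\}$; only replacement queries keeping each position in at most one $R_\sigma$ are considered. $\Delta_\Sigma$ is the set of single-tuple changes $\mathrm{insert}_{R_\sigma}(p)$ (with $\mu=R_\sigma(x)\lor x=p$) and $\mathrm{delete}_{R_\sigma}(p)$ (with $\mu=R_\sigma(x)\land x\neq p$) for $\sigma\in\Sigma$. Dynamic programs: states consist of the input database and auxiliary relations over the same domain; for each allowed change query and auxiliary relation $T$ there is an update formula $\varphi^\rho_T(\bar p;\bar x)$; after a change $\rho(\bar a)$ the input is changed accordingly and $T$ becomes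 $\{\bar b\mid\text{old state}\models\varphi^\rho_T(\bar a;\bar b)\}$. The program maintains $(q_L,\Delta)$ if a designated nullary auxiliary relation $Q$ equals $q_L$ of the current input after every non-empty change sequence from $\Delta$ starting from the database representing the empty string and the empty auxiliary database. $\mathrm{DynFO}$: first-order update formulas. "With nullary auxiliary relations": all auxiliary relations have arity $0$ (are bits). -}

module Defs where

open import Data.Nat using (ℕ; zero; suc)
open import Data.Fin using (Fin; zero; suc; fromℕ; _<?_; _≟_)
open import Data.Bool using (Bool; true; false; _∧_; _∨_; not; if_then_else_)
open import Data.Maybe using (Maybe; just; nothing)
open import Data.List using (List; []; _∷_; mapMaybe; allFin; foldl)
open import Data.Product using (Σ; _×_; _,_; ∃; ∃-syntax)
open import Data.Sum using (_⊎_; inj₁; inj₂; [_,_])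
open import Data.Unit using (⊤)
open import Data.Empty using (⊥)
open import Relation.Nullary using (¬_; does)
open import Relation.Binary.PropositionalEquality using (_≡_)
open import Function.Bundles using (_⇔_)

-- Alphabet Σ = Fin k.  Domain of a database of size (suc N) is Fin (suc N)
-- (positions 1..n are rendered as 0..N, order = order on Fin,
--  min = zero, max = fromℕ N).

DB : ℕ → ℕ → Set
DB k N = Fin k → Fin (suc N) → Bool

Valid : ∀ {k N} → DB k N → Set
Valid {k} {N} db = (i : Fin (suc N)) (σ τ : Fin k) →
  db σ i ≡ true → db τ i ≡ true → σ ≡ τ

-- the letter carried by a position (ε = nothing); unambiguous for valid DBs
letter : ∀ {k} → (Fin k → Bool) → Maybe (Fin k)
letter {zero}  f = nothing
letter {suc k} f = if f zero then just zero else Data.Maybe.map suc (letter (λ σ → f (suc σ)))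

word : ∀ {k N} → DB k N → List (Fin k)
word {k} {N} db = mapMaybe (λ i → letter (λ σ → db σ i)) (allFin (suc N))

record DFA (k : ℕ) : Set where
  field
    size   : ℕ
    start  : Fin size
    δ      : Fin size → Fin k → Fin size
    accept : Fin size → Bool

accepts : ∀ {k} → DFA k → List (Fin k) → Bool
accepts A w = DFA.accept A (foldl (DFA.δ A) (DFA.start A) w)

IsRegular : ∀ {k} → (List (Fin k) → Set) → Set
IsRegular {k} L = ∃[ A ] ((w : List (Fin k)) → L w ⇔ (accepts A w ≡ true))

-- First-order logic over the schema {<, min, max, R_σ (σ ∈ Fin k)}
-- extended by `a` nullary (auxiliary) relation symbols.
-- Variables are de Bruijn indices Fin v.

data Term (v : ℕ) : Set where
  var      : Fin v → Term v
  min' max' : Term v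

data Formula (k a : ℕ) : ℕ → Set where
  tt ff     : ∀ {v} → Formula k a v
  _≐_ _≺_   : ∀ {v} → Term v → Term v → Formula k a v
  rel       : ∀ {v} → Fin k → Term v → Formula k a v
  aux       : ∀ {v} → Fin a → Formula k a v
  ¬'_       : ∀ {v} → Formula k a v → Formula k a v
  _∧'_ _∨'_ : ∀ {v} → Formula k a v → Formula k a v → Formula k a v
  ∃' ∀'     : ∀ {v} → Formula k a (suc v) → Formula k a v

anyᶠ : ∀ {n} → (Fin n → Bool) → Bool
anyᶠ {zero}  f = false
anyᶠ {suc n} f = f zero ∨ anyᶠ (λ i → f (suc i))

allᶠ : ∀ {n} → (Fin n → Bool) → Bool
allᶠ {zero}  f = true
allᶠ {suc n} f = f zero ∧ allᶠ (λ i → f (suc i))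

_▷_ : ∀ {v} {D : Set} → D → (Fin v → D) → Fin (suc v) → D
(x ▷ ρ) zero    = x
(x ▷ ρ) (suc i) = ρ i

evalT : ∀ {v N} → (Fin v → Fin (suc N)) → Term v → Fin (suc N)
evalT ρ (var i) = ρ i
evalT {N = N} ρ min' = zero
evalT {N = N} ρ max' = fromℕ N

eval : ∀ {k a v N} → Formula k a v → DB k N → (Fin a → Bool) →
       (Fin v → Fin (suc N)) → Bool
eval tt db A ρ = true
eval ff db A ρ = false
eval (s ≐ t) db A ρ = does (evalT ρ s ≟ evalT ρ t)
eval (s ≺ t) db A ρ = does (evalT ρ s <? evalT ρ t)
eval (rel σ t) db A ρ = db σ (evalT ρ t)
eval (aux j) db A ρ = A j
eval (¬' φ) db A ρ = not (eval φ db A ρ)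
eval (φ ∧' ψ) db A ρ = eval φ db A ρ ∧ eval ψ db A ρ
eval (φ ∨' ψ) db A ρ = eval φ db A ρ ∨ eval ψ db A ρ
eval (∃' φ) db A ρ = anyᶠ (λ x → eval φ db A (x ▷ ρ))
eval (∀' φ) db A ρ = allᶠ (λ x → eval φ db A (x ▷ ρ))

-- Replacement queries ρ(p̄): rules R_σ := μ_σ(p̄; x) for some σ's.
-- μ_σ is a first-order formula over the input schema (no auxiliary
-- symbols) with free variables x = var zero and p_j = var (suc j).

record RQ (k : ℕ) : Set where
  field
    arity : ℕ
    rules : Fin k → Maybe (Formula k 0 (suc arity)) -- nothing: R_σ unchanged

noAux : Fin 0 → Bool
noAux ()

applyRQ : ∀ {k N} (ρ : RQ k) → (Fin (RQ.arity ρ) → Fin (suc N)) → DB k N → DB k N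
applyRQ ρ ā db σ b with RQ.rules ρ σ
... | nothing = db σ b
... | just μ  = eval μ db noAux (b ▷ ā)

Preserving : ∀ {k} → RQ k → Set
Preserving {k} ρ = ∀ N (db : DB k N) (ā : Fin (RQ.arity ρ) → Fin (suc N)) →
  Valid db → Valid (applyRQ ρ ā db)

insertRQ deleteRQ : ∀ {k} → Fin k → RQ k
insertRQ σ = record { arity = 1 ; rules = λ τ → if does (τ ≟ σ)
  then just (rel σ (var zero) ∨' (var zero ≐ var (suc zero))) else nothing }
deleteRQ σ = record { arity = 1 ; rules = λ τ → if does (τ ≟ σ)
  then just (rel σ (var zero) ∧' (¬' (var zero ≐ var (suc zero)))) else nothing }

ΔΣ : ∀ {k} → Bool × Fin k → RQ k
ΔΣ (true  , σ) = insertRQ σ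
ΔΣ (false , σ) = deleteRQ σ

ΔΣ∪ : ∀ {k} → RQ k → (Bool × Fin k) ⊎ ⊤ → RQ k
ΔΣ∪ ρ = [ ΔΣ , (λ _ → ρ) ]

-- Dynamic programs with nullary auxiliary relations (DynFO):
-- `a` auxiliary bits, for each allowed change query i and each bit T an
-- update formula φ^i_T(p̄) (first-order, over input + aux schema),
-- and a designated bit Q.

record DynProg {I : Set} (k a : ℕ) (Δ : I → RQ k) : Set where
  field
    update : (i : I) → Fin a → Formula k a (RQ.arity (Δ i))
    Q      : Fin a

Change : ∀ {I : Set} {k} → (I → RQ k) → ℕ → Set
Change {I} Δ N = Σ I (λ i → Fin (RQ.arity (Δ i)) → Fin (suc N))

State : ℕ → ℕ → ℕ → Set
State k a N = DB k N × (Fin a → Bool)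

initial : ∀ {k a N} → State k a N
initial = (λ _ _ → false) , (λ _ → false)

step : ∀ {I : Set} {k a N} {Δ : I → RQ k} → DynProg k a Δ →
       State k a N → Change Δ N → State k a N
step {Δ = Δ} P (db , A) (i , ā) =
  applyRQ (Δ i) ā db , (λ T → eval (DynProg.update P i T) db A ā)

run : ∀ {I : Set} {k a N} {Δ : I → RQ k} → DynProg k a Δ →
      State k a N → List (Change Δ N) → State k a N
run P s []       = s
run P s (c ∷ cs) = run P (step P s c) cs

ValidSeq : ∀ {I : Set} {k N} (Δ : I → RQ k) → DB k N → List (Change Δ N) → Set
ValidSeq Δ db []             = ⊤
ValidSeq Δ db ((i , ā) ∷ cs) = Valid (applyRQ (Δ i) ā db) × ValidSeq Δ (applyRQ (Δ i) ā db) cs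

Maintains : ∀ {I : Set} {k a} {Δ : I → RQ k} → DynProg k a Δ →
            (List (Fin k) → Set) → Set
Maintains {k = k} {a} {Δ} P L = ∀ N (c : Change Δ N) (cs : List (Change Δ N)) →
  ValidSeq Δ (λ _ _ → false) (c ∷ cs) →
  let s = run P (initial {k} {a} {N}) (c ∷ cs) in
  (Data.Product.proj₂ s (DynProg.Q P) ≡ true) ⇔ L (word (Data.Product.proj₁ s))

DynFO⁰ : ∀ {I : Set} {k} → (List (Fin k) → Set) → (I → RQ k) → Set
DynFO⁰ L Δ = ∃[ a ] Σ (DynProg _ a Δ) (λ P → Maintains P L)

module Submission where

-- Theorem 13.  Witnesses: Σ = {a}, L = the words of odd length, and
-- ρ = "R_a := all positions" (no parameters).
--
-- Under Δ_Σ one bit suffices: it holds the parity of |R_a| and is updated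
-- by Q' = Q ⊕ R_a(p) ⊕ b, where b says whether the change is an insertion.
--
-- Under Δ_Σ ∪ {ρ} no program with nullary auxiliary relations exists:
-- applying ρ to the empty initial state yields a^(n+1), so the new Q must be
-- its parity; but Q's update formula is then evaluated on the empty database
-- with all bits false, i.e. it is a first-order sentence about a bare linear
-- order, and such a sentence of "weight" w takes the same value on orders of
-- sizes w+1 and w+2.  This is an Ehrenfeucht–Fraïssé argument: assignments
-- are T-similar if all pairs of terms have the same order and distance up to
-- T, and a quantifier move is answered at threshold T from 2T-similarity.

open import Defs
open import Data.Nat using (ℕ; zero; suc; _+_; _∸_; _⊓_; _≤_; _<_; _≤?_; z≤n; s≤s)
open import Data.Nat.Properties
  using (≤-refl; ≤-reflexive; ≤-trans; ≤-antisym; ≤-total; ≰⇒>; <⇒≤; <⇒≱; n≤1+n;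
         +-comm; +-assoc; +-identityʳ; +-monoˡ-≤; +-monoʳ-≤; m≤m+n; m≤n+m;
         m+n≤o⇒n≤o; m+n≤o⇒m≤o∸n; m≤o∸n⇒m+n≤o;
         n∸n≡0; m∸n≤m; m≤n⇒m∸n≡0; m∸n≡0⇒m≤n; ∸-monoˡ-≤; ∸-+-assoc; +-∸-assoc;
         m+[n∸m]≡n; m∸n+n≡m; [m+n]∸[m+o]≡n∸o;
         ⊓-assoc; ⊓-glb; m⊓n≤n; m≤n⇒m⊓n≡m; m≥n⇒m⊓n≡n)
open import Data.Fin using (Fin; zero; suc; toℕ; fromℕ<; _≟_; _<?_)
open import Data.Fin.Properties
  using (toℕ-fromℕ; toℕ-fromℕ<; toℕ≤pred[n]; toℕ-injective; suc-injective)
open import Data.Bool using (Bool; true; false; _∧_; _∨_; not; _xor_; if_then_else_)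
open import Data.Bool.Properties
  using (xor-assoc; xor-comm; xor-identityʳ; xor-same; xor-is-ok;
         not-distribˡ-xor; not-distribʳ-xor;
         ∨-identityʳ; ∨-zeroʳ; ∧-identityʳ; ∧-zeroʳ; not-¬; ⇔→≡)
open import Data.Maybe using (just; nothing)
open import Data.List using (List; []; _∷_; map; allFin; foldl; tabulate; mapMaybe; filter)
open import Data.List.Relation.Unary.All using (lookup)
open import Data.List.Relation.Unary.All.Properties using (all-filter)
open import Data.List.Relation.Unary.Any using (here; there)
open import Data.List.Membership.Propositional using (_∈_)
open import Data.List.Membership.Propositional.Properties using (∈-map⁺; ∈-allFin; ∈-filter⁺)
open import Data.List.Extrema.Nat
  using (argmax; argmin; f[argmax]≤v⁺; v≤f[argmin]⁺; f[xs]≤f[argmax]; f[argmin]≤f[xs])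
open import Data.Product using (Σ; _×_; _,_; proj₁; proj₂; ∃-syntax)
open import Data.Sum using (inj₁; inj₂)
open import Data.Unit using (tt)
open import Data.Empty using (⊥)
open import Relation.Nullary using (¬_; yes; no)
open import Relation.Nullary.Decidable using (dec-true; dec-false; does-⇔)
open import Relation.Binary.PropositionalEquality
open import Function.Bundles using (mk⇔; Equivalence)

-- §1  Parity and the language of odd-length words

parity : ∀ {n} → (Fin n → Bool) → Bool
parity {zero}  h = false
parity {suc n} h = h zero xor parity (λ i → h (suc i))

parity-cong : ∀ {n} {h h' : Fin n → Bool} → (∀ x → h x ≡ h' x) → parity h ≡ parity h'
parity-cong {zero}  e = refl
parity-cong {suc n} e = cong₂ _xor_ (e zero) (parity-cong (λ i → e (suc i)))

parity-false : ∀ n → parity {n} (λ _ → false) ≡ false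
parity-false zero    = refl
parity-false (suc n) = parity-false n

xor-exchange : ∀ a b r → b xor r ≡ (a xor r) xor (a xor b)
xor-exchange a b r = begin
  b xor r                   ≡⟨ xor-comm b r ⟩
  r xor b                   ≡⟨ cong (r xor_) (cong (_xor b) (sym (xor-same a))) ⟩
  r xor ((a xor a) xor b)   ≡⟨ cong (r xor_) (xor-assoc a a b) ⟩
  r xor (a xor (a xor b))   ≡⟨ sym (xor-assoc r a (a xor b)) ⟩
  (r xor a) xor (a xor b)   ≡⟨ cong (_xor (a xor b)) (xor-comm r a) ⟩
  (a xor r) xor (a xor b)   ∎
  where open ≡-Reasoning

parity-update : ∀ {n} (h h' : Fin n → Bool) (p : Fin n) →
                (∀ x → x ≢ p → h' x ≡ h x) → parity h' ≡ parity h xor (h p xor h' p)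
parity-update {suc n} h h' zero off =
  trans (cong (h' zero xor_) (parity-cong (λ i → off (suc i) (λ ()))))
        (xor-exchange (h zero) (h' zero) _)
parity-update {suc n} h h' (suc q) off =
  trans (cong₂ _xor_ (off zero (λ ()))
                     (parity-update (λ i → h (suc i)) (λ i → h' (suc i)) q
                                    (λ x x≢q → off (suc x) (λ e → x≢q (suc-injective e)))))
        (sym (xor-assoc (h zero) _ _))

oddLength : ∀ {A : Set} → List A → Bool
oddLength []      = false
oddLength (_ ∷ w) = not (oddLength w)

Σ₁ : ℕ
Σ₁ = 1

letter-a : Fin Σ₁
letter-a = zero

Lang : List (Fin Σ₁) → Set
Lang w = oddLength w ≡ true

toggle : Fin 2 → Fin 2
toggle zero    = suc zero
toggle (suc _) = zero

isOdd : Fin 2 → Bool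
isOdd zero    = false
isOdd (suc _) = true

parityDFA : DFA Σ₁
parityDFA = record { size = 2 ; start = zero ; δ = λ s _ → toggle s ; accept = isOdd }

run-parityDFA : ∀ s (w : List (Fin Σ₁)) →
                isOdd (foldl (λ s _ → toggle s) s w) ≡ isOdd s xor oddLength w
run-parityDFA s [] = sym (xor-identityʳ (isOdd s))
run-parityDFA s (_ ∷ w) =
  trans (run-parityDFA (toggle s) w) (trans (cong (_xor oddLength w) (toggle-flips s))
            (trans (sym (not-distribˡ-xor (isOdd s) _)) (not-distribʳ-xor (isOdd s) _)))
  where
  toggle-flips : ∀ s → isOdd (toggle s) ≡ not (isOdd s)
  toggle-flips zero          = refl
  toggle-flips (suc zero)    = refl

Lang-regular : IsRegular Lang
Lang-regular = parityDFA , λ w → mk⇔ (λ e → trans (run-parityDFA zero w) e)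
                                     (λ e → trans (sym (run-parityDFA zero w)) e)

oddLength-marked : ∀ {A : Set} {n} (e : Fin n → A) (h : A → Bool) →
  oddLength (mapMaybe (λ x → if h x then just letter-a else nothing) (tabulate e))
  ≡ parity (λ i → h (e i))
oddLength-marked {n = zero} e h = refl
oddLength-marked {n = suc n} e h with h (e zero)
... | true  = cong not (oddLength-marked (λ i → e (suc i)) h)
... | false = oddLength-marked (λ i → e (suc i)) h

oddLength-word : ∀ {N} (db : DB Σ₁ N) → oddLength (word db) ≡ parity (db letter-a)
oddLength-word {N} db = oddLength-marked {n = suc N} (λ i → i) (db letter-a)

unary-valid : ∀ {N} (db : DB Σ₁ N) → Valid db
unary-valid db i zero zero _ _ = refl

-- §2  Maintaining the parity under Δ_Σ with one bit

_⊕'_ : ∀ {k a v} → Formula k a v → Formula k a v → Formula k a v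
φ ⊕' ψ = (φ ∨' ψ) ∧' (¬' (φ ∧' ψ))

eval-⊕' : ∀ {k a v N} (φ ψ : Formula k a v) (db : DB k N) A ρ →
          eval (φ ⊕' ψ) db A ρ ≡ eval φ db A ρ xor eval ψ db A ρ
eval-⊕' φ ψ db A ρ = sym (xor-is-ok (eval φ db A ρ) (eval ψ db A ρ))

constant : ∀ {k a v} → Bool → Formula k a v
constant true  = tt
constant false = ff

flipBy : Bool → Formula Σ₁ 1 1
flipBy b = (aux zero ⊕' rel letter-a (var zero)) ⊕' constant b

eval-flipBy : ∀ {N} (b : Bool) (db : DB Σ₁ N) B (ā : Fin 1 → Fin (suc N)) →
              eval (flipBy b) db B ā ≡ (B zero xor db letter-a (ā zero)) xor b
eval-flipBy b db B ā =
  trans (eval-⊕' (aux zero ⊕' rel letter-a (var zero)) (constant b) db B ā)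
        (cong₂ _xor_ (eval-⊕' (aux zero) (rel letter-a (var zero)) db B ā) (eval-constant b))
  where
  eval-constant : ∀ b → eval (constant {Σ₁} {1} {1} b) db B ā ≡ b
  eval-constant true  = refl
  eval-constant false = refl

parityProgram : DynProg Σ₁ 1 ΔΣ
parityProgram = record { update = update ; Q = zero }
  where
  update : (i : Bool × Fin Σ₁) → Fin 1 → Formula Σ₁ 1 (RQ.arity (ΔΣ i))
  update (true  , zero) zero = flipBy true
  update (false , zero) zero = flipBy false

PointUpdate : ∀ {n} → (Fin n → Bool) → (Fin n → Bool) → Fin n → Bool → Set
PointUpdate h h' p b = (∀ x → x ≢ p → h' x ≡ h x) × h' p ≡ b

parity-set : ∀ {n} {h h' : Fin n → Bool} {p b} → PointUpdate h h' p b →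
             parity h' ≡ (parity h xor h p) xor b
parity-set {h = h} {h'} {p} {b} (off , at) = begin
  parity h'                       ≡⟨ parity-update h h' p off ⟩
  parity h xor (h p xor h' p)     ≡⟨ cong (λ z → parity h xor (h p xor z)) at ⟩
  parity h xor (h p xor b)        ≡⟨ sym (xor-assoc (parity h) (h p) b) ⟩
  (parity h xor h p) xor b        ∎
  where open ≡-Reasoning

insert-point : ∀ {N} (ā : Fin 1 → Fin (suc N)) (db : DB Σ₁ N) →
               PointUpdate (db letter-a) (applyRQ (insertRQ letter-a) ā db letter-a) (ā zero) true
insert-point ā db =
  (λ x x≢p → trans (cong (db letter-a x ∨_) (dec-false (x ≟ ā zero) x≢p)) (∨-identityʳ _)) ,
  trans (cong (db letter-a (ā zero) ∨_) (dec-true (ā zero ≟ ā zero) refl)) (∨-zeroʳ _)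

delete-point : ∀ {N} (ā : Fin 1 → Fin (suc N)) (db : DB Σ₁ N) →
               PointUpdate (db letter-a) (applyRQ (deleteRQ letter-a) ā db letter-a) (ā zero) false
delete-point ā db =
  (λ x x≢p → trans (cong (λ z → db letter-a x ∧ not z) (dec-false (x ≟ ā zero) x≢p))
                    (∧-identityʳ _)) ,
  trans (cong (λ z → db letter-a (ā zero) ∧ not z) (dec-true (ā zero ≟ ā zero) refl)) (∧-zeroʳ _)

ParityInv : ∀ {N} → State Σ₁ 1 N → Set
ParityInv (db , B) = B zero ≡ parity (db letter-a)

flipBy-correct : ∀ {N} (b : Bool) (db : DB Σ₁ N) B (ā : Fin 1 → Fin (suc N))
                 {h' : Fin (suc N) → Bool} →
                 B zero ≡ parity (db letter-a) → PointUpdate (db letter-a) h' (ā zero) b →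
                 eval (flipBy b) db B ā ≡ parity h'
flipBy-correct b db B ā inv upd =
  trans (eval-flipBy b db B ā)
        (trans (cong (λ q → (q xor db letter-a (ā zero)) xor b) inv) (sym (parity-set upd)))

step-parityInv : ∀ {N} (s : State Σ₁ 1 N) (c : Change ΔΣ N) → ParityInv s →
                 ParityInv (step parityProgram s c)
step-parityInv (db , B) ((true  , zero) , ā) inv = flipBy-correct true  db B ā inv (insert-point ā db)
step-parityInv (db , B) ((false , zero) , ā) inv = flipBy-correct false db B ā inv (delete-point ā db)

run-parityInv : ∀ {N} (s : State Σ₁ 1 N) cs → ParityInv s → ParityInv (run parityProgram s cs)
run-parityInv s []       inv = inv
run-parityInv s (c ∷ cs) inv = run-parityInv (step parityProgram s c) cs (step-parityInv s c inv)

parityProgram-maintains : Maintains parityProgram Lang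
parityProgram-maintains N c cs _ = mk⇔ (λ e → trans (sym Q≡odd) e) (λ e → trans Q≡odd e)
  where
  s = run parityProgram (initial {Σ₁} {1} {N}) (c ∷ cs)
  Q≡odd : proj₂ s zero ≡ oddLength (word (proj₁ s))
  Q≡odd = trans (run-parityInv initial (c ∷ cs) (sym (parity-false (suc N))))
                (sym (oddLength-word (proj₁ s)))

-- §3  Agreement up to a threshold, and similar pairs of numbers

infix 4 _≈[_]_
_≈[_]_ : ℕ → ℕ → ℕ → Set
m ≈[ T ] n = T ⊓ m ≡ T ⊓ n

⊓-⊓-absorb : ∀ {T₁ T₂} → T₁ ≤ T₂ → ∀ m → T₁ ⊓ (T₂ ⊓ m) ≡ T₁ ⊓ m
⊓-⊓-absorb {T₁} {T₂} le m = trans (sym (⊓-assoc T₁ T₂ m)) (cong (_⊓ m) (m≤n⇒m⊓n≡m le))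

≈-weaken : ∀ {T₁ T₂ m n} → T₁ ≤ T₂ → m ≈[ T₂ ] n → m ≈[ T₁ ] n
≈-weaken {T₁} {m = m} {n} le e =
  trans (sym (⊓-⊓-absorb le m)) (trans (cong (T₁ ⊓_) e) (⊓-⊓-absorb le n))

⊓-both-reach : ∀ {T m n} → T ≤ m → T ≤ n → T ⊓ m ≡ T ⊓ n
⊓-both-reach T≤m T≤n = trans (m≤n⇒m⊓n≡m T≤m) (sym (m≤n⇒m⊓n≡m T≤n))

⊓-+-truncate : ∀ T m n → T ⊓ (m + n) ≡ T ⊓ (m + T ⊓ n)
⊓-+-truncate T m n with ≤-total T n
... | inj₁ T≤n = ⊓-both-reach (≤-trans T≤n (m≤n+m n m))
                              (subst (λ z → T ≤ m + z) (sym (m≤n⇒m⊓n≡m T≤n)) (m≤n+m T m))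
... | inj₂ n≤T = cong (λ z → T ⊓ (m + z)) (sym (m≥n⇒m⊓n≡n n≤T))

≈-+ : ∀ {T m m' n n'} → m ≈[ T ] n → m' ≈[ T ] n' → m + m' ≈[ T ] n + n'
≈-+ {T} {m} {m'} {n} {n'} e e' = begin
  T ⊓ (m + m')            ≡⟨ ⊓-+-truncate T m m' ⟩
  T ⊓ (m + T ⊓ m')        ≡⟨ cong (T ⊓_) (+-comm m _) ⟩
  T ⊓ (T ⊓ m' + m)        ≡⟨ ⊓-+-truncate T _ m ⟩
  T ⊓ (T ⊓ m' + T ⊓ m)    ≡⟨ cong₂ (λ y z → T ⊓ (y + z)) e' e ⟩
  T ⊓ (T ⊓ n' + T ⊓ n)    ≡⟨ sym (⊓-+-truncate T _ n) ⟩
  T ⊓ (T ⊓ n' + n)        ≡⟨ cong (T ⊓_) (+-comm _ n) ⟩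
  T ⊓ (n + T ⊓ n')        ≡⟨ sym (⊓-+-truncate T n n') ⟩
  T ⊓ (n + n')            ∎
  where open ≡-Reasoning

-- subtracting d costs d of the threshold
⊓-∸-truncate : ∀ {d T₁ T₂} → d + T₁ ≤ T₂ → ∀ m → T₁ ⊓ (m ∸ d) ≡ T₁ ⊓ (T₂ ⊓ m ∸ d)
⊓-∸-truncate {d} {T₁} {T₂} le m with ≤-total T₂ m
... | inj₁ T₂≤m = ⊓-both-reach (≤-trans T₁≤T₂∸d (∸-monoˡ-≤ d T₂≤m))
                               (subst (λ z → T₁ ≤ z ∸ d) (sym (m≤n⇒m⊓n≡m T₂≤m)) T₁≤T₂∸d)
  where T₁≤T₂∸d = m+n≤o⇒m≤o∸n T₁ (subst (_≤ T₂) (+-comm d T₁) le)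
... | inj₂ m≤T₂ = cong (λ z → T₁ ⊓ (z ∸ d)) (sym (m≥n⇒m⊓n≡n m≤T₂))

≈-∸ : ∀ {d T₁ T₂ m n} → d + T₁ ≤ T₂ → m ≈[ T₂ ] n → m ∸ d ≈[ T₁ ] n ∸ d
≈-∸ {d} {T₁} {m = m} {n} le e =
  trans (⊓-∸-truncate le m) (trans (cong (λ z → T₁ ⊓ (z ∸ d)) e) (sym (⊓-∸-truncate le n)))

∸-⊓-truncate : ∀ {d T} → d ≤ T → ∀ m → d ∸ m ≡ d ∸ (T ⊓ m)
∸-⊓-truncate {d} {T} d≤T m with ≤-total T m
... | inj₁ T≤m = trans (m≤n⇒m∸n≡0 (≤-trans d≤T T≤m))
                       (sym (trans (cong (d ∸_) (m≤n⇒m⊓n≡m T≤m)) (m≤n⇒m∸n≡0 d≤T)))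
... | inj₂ m≤T = cong (d ∸_) (sym (m≥n⇒m⊓n≡n m≤T))

∸-≈ : ∀ {d T m n} → d ≤ T → m ≈[ T ] n → d ∸ m ≡ d ∸ n
∸-≈ {d} {m = m} {n} d≤T e =
  trans (∸-⊓-truncate d≤T m) (trans (cong (d ∸_) e) (sym (∸-⊓-truncate d≤T n)))

≈-zero : ∀ {T m n} → 1 ≤ T → m ≈[ T ] n → m ≡ 0 → n ≡ 0
≈-zero {suc T} {zero} {zero}  _ _  _ = refl
≈-zero {suc T} {zero} {suc n} _ () _

≈-lower : ∀ {T m n c} → c ≤ T → c ≤ m → m ≈[ T ] n → c ≤ n
≈-lower {T} {m} {n} c≤T c≤m e = ≤-trans (⊓-glb c≤T c≤m) (≤-trans (≤-reflexive e) (m⊓n≤n T n))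

-- (a , b) and (a' , b') are T-similar: the distances b ∸ a and a ∸ b
-- agree up to T; for T ≥ 1 this includes having the same order
record Similar (T a b a' b' : ℕ) : Set where
  constructor similar
  field
    upward   : b ∸ a ≈[ T ] b' ∸ a'
    downward : a ∸ b ≈[ T ] a' ∸ b'

Similar-refl : ∀ {T} a a' → Similar T a a a' a'
Similar-refl {T} a a' = similar (cong (T ⊓_) same) (cong (T ⊓_) same)
  where same = trans (n∸n≡0 a) (sym (n∸n≡0 a'))

Similar-swap : ∀ {T a b a' b'} → Similar T a b a' b' → Similar T b a b' a'
Similar-swap (similar p q) = similar q p

Similar-sym : ∀ {T a b a' b'} → Similar T a b a' b' → Similar T a' b' a b
Similar-sym (similar p q) = similar (sym p) (sym q)

Similar-weaken : ∀ {T₁ T₂ a b a' b'} → T₁ ≤ T₂ → Similar T₂ a b a' b' → Similar T₁ a b a' b'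
Similar-weaken le (similar p q) = similar (≈-weaken le p) (≈-weaken le q)

Similar-untranslate : ∀ {T} d {a b a' b'} →
                      Similar T (d + a) (d + b) (d + a') (d + b') → Similar T a b a' b'
Similar-untranslate {T} d {a} {b} {a'} {b'} (similar p q) = similar
  (subst₂ (λ y z → T ⊓ y ≡ T ⊓ z) ([m+n]∸[m+o]≡n∸o d b a) ([m+n]∸[m+o]≡n∸o d b' a') p)
  (subst₂ (λ y z → T ⊓ y ≡ T ⊓ z) ([m+n]∸[m+o]≡n∸o d a b) ([m+n]∸[m+o]≡n∸o d a' b') q)

+-∸-split : ∀ d s t → (d + s) ∸ t ≡ (d ∸ (t ∸ s)) + (s ∸ t)
+-∸-split d s t with ≤-total t s
... | inj₁ t≤s rewrite m≤n⇒m∸n≡0 t≤s = +-∸-assoc d t≤s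
... | inj₂ s≤t rewrite m≤n⇒m∸n≡0 s≤t = begin
  (d + s) ∸ t              ≡⟨ cong₂ _∸_ (+-comm d s) (sym (m+[n∸m]≡n s≤t)) ⟩
  (s + d) ∸ (s + (t ∸ s))  ≡⟨ [m+n]∸[m+o]≡n∸o s d (t ∸ s) ⟩
  d ∸ (t ∸ s)              ≡⟨ sym (+-identityʳ _) ⟩
  d ∸ (t ∸ s) + 0          ∎
  where open ≡-Reasoning

Similar-shift : ∀ {T d s t s' t'} → d ≤ T → Similar (T + T) s t s' t' →
                Similar T (d + s) t (d + s') t'
Similar-shift {T} {d} {s} {t} {s'} {t'} d≤T (similar p q) = similar
  (subst₂ (λ y z → T ⊓ y ≡ T ⊓ z) (below t s) (below t' s') (≈-∸ (+-monoˡ-≤ T d≤T) p))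
  (subst₂ (λ y z → T ⊓ y ≡ T ⊓ z) (sym (+-∸-split d s t)) (sym (+-∸-split d s' t'))
          (≈-+ (cong (T ⊓_) (∸-≈ (≤-trans d≤T (m≤m+n T T)) p)) (≈-weaken (m≤m+n T T) q)))
  where
  below : ∀ t s → (t ∸ s) ∸ d ≡ t ∸ (d + s)
  below t s = trans (∸-+-assoc t s d) (cong (t ∸_) (+-comm s d))

Similar-shift-down : ∀ {T d x x' t t'} → d ≤ T → Similar (T + T) (d + x) t (d + x') t' →
                     Similar T x t x' t'
Similar-shift-down {d = d} d≤T h =
  Similar-untranslate d (Similar-swap (Similar-shift d≤T (Similar-swap h)))

Similar-far : ∀ {T a b a' b'} → T + a ≤ b → T + a' ≤ b' → Similar T a b a' b'
Similar-far {T} {a} {b} {a'} {b'} le le' = similar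
  (⊓-both-reach (m+n≤o⇒m≤o∸n T le) (m+n≤o⇒m≤o∸n T le'))
  (cong (T ⊓_) (trans (m≤n⇒m∸n≡0 (m+n≤o⇒n≤o T le))
                      (sym (m≤n⇒m∸n≡0 (m+n≤o⇒n≤o T le')))))

Similar-≥ : ∀ {T a b a' b'} → 1 ≤ T → Similar T a b a' b' → b ≤ a → b' ≤ a'
Similar-≥ 1≤T (similar p _) b≤a = m∸n≡0⇒m≤n (≈-zero 1≤T p (m≤n⇒m∸n≡0 b≤a))

Similar-≡ : ∀ {T a b a' b'} → 1 ≤ T → Similar T a b a' b' → a ≡ b → a' ≡ b'
Similar-≡ 1≤T h refl = ≤-antisym (Similar-≥ 1≤T (Similar-swap h) ≤-refl) (Similar-≥ 1≤T h ≤-refl)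

Similar-< : ∀ {T a b a' b'} → 1 ≤ T → Similar T a b a' b' → a < b → a' < b'
Similar-< 1≤T h a<b = ≰⇒> (λ b'≤a' → <⇒≱ a<b (Similar-≥ 1≤T (Similar-sym h) b'≤a'))

-- §4  Similar assignments and the extension step

val : ∀ {v N} → (Fin v → Fin (suc N)) → Term v → ℕ
val ρ t = toℕ (evalT ρ t)

val-max : ∀ {v N} (ρ : Fin v → Fin (suc N)) → val ρ max' ≡ N
val-max {N = N} ρ = toℕ-fromℕ N

val-≤ : ∀ {v N} (ρ : Fin v → Fin (suc N)) t → val ρ t ≤ N
val-≤ ρ t = toℕ≤pred[n] (evalT ρ t)

Sim : ∀ {v N N'} → ℕ → (Fin v → Fin (suc N)) → (Fin v → Fin (suc N')) → Set
Sim {v} T ρ ρ' = (s t : Term v) → Similar T (val ρ s) (val ρ t) (val ρ' s) (val ρ' t)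

Sim-sym : ∀ {v N N' T} {ρ : Fin v → Fin (suc N)} {ρ' : Fin v → Fin (suc N')} →
          Sim T ρ ρ' → Sim T ρ' ρ
Sim-sym H s t = Similar-sym (H s t)

Sim-weaken : ∀ {v N N' T₁ T₂} {ρ : Fin v → Fin (suc N)} {ρ' : Fin v → Fin (suc N')} →
             T₁ ≤ T₂ → Sim T₂ ρ ρ' → Sim T₁ ρ ρ'
Sim-weaken le H s t = Similar-weaken le (H s t)

Sim-closed : ∀ {N N' T} (ρ : Fin 0 → Fin (suc N)) (ρ' : Fin 0 → Fin (suc N')) →
             T ≤ N → T ≤ N' → Sim T ρ ρ'
Sim-closed {N} {N'} {T} ρ ρ' T≤N T≤N' = sim
  where
  max-far : ∀ {M} (σ : Fin 0 → Fin (suc M)) → T ≤ M → T + 0 ≤ val σ max'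
  max-far {M} σ T≤M = subst₂ _≤_ (sym (+-identityʳ T)) (sym (val-max σ)) T≤M
  min-max : Similar T 0 (val ρ max') 0 (val ρ' max')
  min-max = Similar-far (max-far ρ T≤N) (max-far ρ' T≤N')
  sim : Sim T ρ ρ'
  sim (var ())
  sim min' (var ())
  sim max' (var ())
  sim min' min' = Similar-refl 0 0
  sim max' max' = Similar-refl _ _
  sim min' max' = min-max
  sim max' min' = Similar-swap min-max

module _ {v N N' T} {ρ : Fin v → Fin (suc N)} {ρ' : Fin v → Fin (suc N')}
         (H : Sim T ρ ρ') (x : Fin (suc N)) (x' : Fin (suc N'))
         (R : ∀ t → Similar T (toℕ x) (val ρ t) (toℕ x') (val ρ' t)) where

  private
    R⁺ : ∀ t → Similar T (toℕ x) (val (x ▷ ρ) t) (toℕ x') (val (x' ▷ ρ') t)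
    R⁺ (var zero)    = Similar-refl (toℕ x) (toℕ x')
    R⁺ (var (suc j)) = R (var j)
    R⁺ min'          = R min'
    R⁺ max'          = R max'

  Sim-extend : Sim T (x ▷ ρ) (x' ▷ ρ')
  Sim-extend (var zero) t                 = R⁺ t
  Sim-extend s (var zero)                 = Similar-swap (R⁺ s)
  Sim-extend (var (suc i)) (var (suc j))  = H (var i) (var j)
  Sim-extend (var (suc i)) min'           = H (var i) min'
  Sim-extend (var (suc i)) max'           = H (var i) max'
  Sim-extend min' (var (suc j))           = H min' (var j)
  Sim-extend min' min'                    = H min' min'
  Sim-extend min' max'                    = H min' max'
  Sim-extend max' (var (suc j))           = H max' (var j)
  Sim-extend max' min'                    = H max' min'
  Sim-extend max' max'                    = H max' max'

allTerms : ∀ v → List (Term v)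
allTerms v = min' ∷ max' ∷ map var (allFin v)

∈-allTerms : ∀ {v} (t : Term v) → t ∈ allTerms v
∈-allTerms (var i) = there (there (∈-map⁺ var (∈-allFin i)))
∈-allTerms min'    = here refl
∈-allTerms max'    = there (here refl)

nearest-below : ∀ {A : Set} (f : A → ℕ) (xs : List A) {X} (d : A) → f d ≤ X →
                Σ A λ l → f l ≤ X × (∀ {t} → t ∈ xs → f t ≤ X → f t ≤ f l)
nearest-below f xs {X} d fd≤X =
  argmax f d below ,
  f[argmax]≤v⁺ fd≤X (all-filter P? xs) ,
  λ t∈xs ft≤X → lookup (f[xs]≤f[argmax] d below) (∈-filter⁺ P? t∈xs ft≤X)
  where
  P? = λ t → f t ≤? X
  below = filter P? xs

nearest-above : ∀ {A : Set} (f : A → ℕ) (xs : List A) {X} (d : A) → X ≤ f d →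
                Σ A λ u → X ≤ f u × (∀ {t} → t ∈ xs → X ≤ f t → f u ≤ f t)
nearest-above f xs {X} d X≤fd =
  argmin f d above ,
  v≤f[argmin]⁺ X≤fd (all-filter P? xs) ,
  λ t∈xs X≤ft → lookup (f[argmin]≤f[xs] d above) (∈-filter⁺ P? t∈xs X≤ft)
  where
  P? = λ t → X ≤? f t
  above = filter P? xs

-- The partner x' of x is placed
-- relative to the nearest terms l ≤ x ≤ u: at the same distance from l
-- (if x is close to l), from u (if x is close to u), or at distance T
-- above l (if x is far from both, so the gap l' .. u' is wide enough).
module Extension {v N N' T} {ρ : Fin v → Fin (suc N)} {ρ' : Fin v → Fin (suc N')}
                 (1≤T : 1 ≤ T) (H : Sim (T + T) ρ ρ') (x : Fin (suc N)) where

  private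
    f = val ρ
    f' = val ρ'
    X = toℕ x

    1≤T+T : 1 ≤ T + T
    1≤T+T = ≤-trans 1≤T (m≤m+n T T)

    below-max : ∀ {M} (σ : Fin v → Fin (suc M)) t → val σ t ≤ val σ max'
    below-max {M} σ t = subst (val σ t ≤_) (sym (val-max σ)) (val-≤ σ t)

    nearest-l = nearest-below f (allTerms v) {X} min' z≤n
    l = proj₁ nearest-l
    l≤X = proj₁ (proj₂ nearest-l)
    l-greatest : ∀ t → f t ≤ X → f t ≤ f l
    l-greatest t = proj₂ (proj₂ nearest-l) (∈-allTerms t)

    X≤max : X ≤ f max'
    X≤max = subst (X ≤_) (sym (val-max ρ)) (toℕ≤pred[n] x)

    nearest-u = nearest-above f (allTerms v) {X} max' X≤max
    u = proj₁ nearest-u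
    X≤u = proj₁ (proj₂ nearest-u)
    u-least : ∀ t → X ≤ f t → f u ≤ f t
    u-least t = proj₂ (proj₂ nearest-u) (∈-allTerms t)

  Partner : Set
  Partner = Σ ℕ λ X' → X' ≤ N' × (∀ t → Similar T X (f t) X' (f' t))

  partner-near-below : X ∸ f l ≤ T → Partner
  partner-near-below d≤T = d + f' l , bound , similar-to
    where
    d = X ∸ f l
    d≤gap' : d ≤ f' max' ∸ f' l
    d≤gap' = ≈-lower (≤-trans d≤T (m≤m+n T T)) (∸-monoˡ-≤ (f l) X≤max)
                     (Similar.upward (H l max'))
    bound : d + f' l ≤ N'
    bound = subst (d + f' l ≤_) (val-max ρ') (m≤o∸n⇒m+n≤o d (below-max ρ' l) d≤gap')
    similar-to : ∀ t → Similar T X (f t) (d + f' l) (f' t)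
    similar-to t = subst (λ z → Similar T z (f t) (d + f' l) (f' t)) (m∸n+n≡m l≤X)
                         (Similar-shift d≤T (H l t))

  partner-near-above : f u ∸ X ≤ T → Partner
  partner-near-above d≤T = f' u ∸ d , ≤-trans (m∸n≤m (f' u) d) (val-≤ ρ' u) , similar-to
    where
    d = f u ∸ X
    d≤u' : d ≤ f' u
    d≤u' = ≈-lower (≤-trans d≤T (m≤m+n T T)) (m∸n≤m (f u) X) (Similar.upward (H min' u))
    similar-to : ∀ t → Similar T X (f t) (f' u ∸ d) (f' t)
    similar-to t = Similar-shift-down d≤T
      (subst₂ (λ y z → Similar (T + T) y (f t) z (f' t))
              (sym (m∸n+n≡m X≤u)) (sym (m+[n∸m]≡n d≤u')) (H u t))

  partner-far : T ≤ X ∸ f l → T ≤ f u ∸ X → Partner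
  partner-far far-l far-u = T + f' l , bound , similar-to
    where
    l-far : T + f l ≤ X
    l-far = m≤o∸n⇒m+n≤o T l≤X far-l
    u-far : T + X ≤ f u
    u-far = m≤o∸n⇒m+n≤o T X≤u far-u
    wide-gap : T + T ≤ f u ∸ f l
    wide-gap = m+n≤o⇒m≤o∸n (T + T)
      (≤-trans (≤-reflexive (+-assoc T T (f l))) (≤-trans (+-monoʳ-≤ T l-far) u-far))
    l'≤u' : f' l ≤ f' u
    l'≤u' = Similar-≥ 1≤T+T (H u l) (≤-trans l≤X X≤u)
    u'-far : T + (T + f' l) ≤ f' u
    u'-far = ≤-trans (≤-reflexive (sym (+-assoc T T (f' l))))
      (m≤o∸n⇒m+n≤o (T + T) l'≤u' (≈-lower ≤-refl wide-gap (Similar.upward (H l u))))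
    bound : T + f' l ≤ N'
    bound = ≤-trans (m≤n+m (T + f' l) T) (≤-trans u'-far (val-≤ ρ' u))
    -- every term lies below l or above u, in both orders
    similar-to : ∀ t → Similar T X (f t) (T + f' l) (f' t)
    similar-to t with ≤-total (f t) X
    ... | inj₁ t≤X = Similar-swap
      (Similar-far (≤-trans (+-monoʳ-≤ T t≤l) l-far) (+-monoʳ-≤ T (Similar-≥ 1≤T+T (H l t) t≤l)))
      where t≤l = l-greatest t t≤X
    ... | inj₂ X≤t =
      Similar-far (≤-trans u-far u≤t) (≤-trans u'-far (Similar-≥ 1≤T+T (H t u) u≤t))
      where u≤t = u-least t X≤t

  partner : Partner
  partner with X ∸ f l ≤? T | f u ∸ X ≤? T
  ... | yes near-l | _          = partner-near-below near-l
  ... | no _       | yes near-u = partner-near-above near-u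
  ... | no far-l   | no far-u   = partner-far (<⇒≤ (≰⇒> far-l)) (<⇒≤ (≰⇒> far-u))

  extend : Σ (Fin (suc N')) λ x' → Sim T (x ▷ ρ) (x' ▷ ρ')
  extend with partner
  ... | X' , X'≤N' , similar-to = x' , Sim-extend (Sim-weaken (m≤m+n T T) H) x x' similar-to'
    where
    x' = fromℕ< (s≤s X'≤N')
    similar-to' : ∀ t → Similar T X (f t) (toℕ x') (f' t)
    similar-to' t =
      subst (λ z → Similar T X (f t) z (f' t)) (sym (toℕ-fromℕ< (s≤s X'≤N'))) (similar-to t)

-- §5  First-order sentences cannot count on linear orders

anyᶠ-witness : ∀ {n} (f : Fin n → Bool) → anyᶠ f ≡ true → Σ (Fin n) λ x → f x ≡ true
anyᶠ-witness {suc n} f e with f zero in fz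
... | true  = zero , fz
... | false = let (x , fx) = anyᶠ-witness (λ i → f (suc i)) e in suc x , fx

anyᶠ-intro : ∀ {n} (f : Fin n → Bool) (x : Fin n) → f x ≡ true → anyᶠ f ≡ true
anyᶠ-intro f zero    fx rewrite fx = refl
anyᶠ-intro f (suc x) fx with f zero
... | true  = refl
... | false = anyᶠ-intro (λ i → f (suc i)) x fx

anyᶠ-match : ∀ {n m} (f : Fin n → Bool) (g : Fin m → Bool) →
             (∀ x → Σ (Fin m) λ y → f x ≡ g y) → (∀ y → Σ (Fin n) λ x → g y ≡ f x) →
             anyᶠ f ≡ anyᶠ g
anyᶠ-match f g forth back = ⇔→≡ (mk⇔ (transfer f g forth) (transfer g f back))
  where
  transfer : ∀ {n m} (f : Fin n → Bool) (g : Fin m → Bool) →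
             (∀ x → Σ (Fin m) λ y → f x ≡ g y) → anyᶠ f ≡ true → anyᶠ g ≡ true
  transfer f g forth e =
    let (x , fx) = anyᶠ-witness f e ; (y , fx≡gy) = forth x
    in anyᶠ-intro g y (trans (sym fx≡gy) fx)

allᶠ-via-anyᶠ : ∀ {n} (f : Fin n → Bool) → allᶠ f ≡ not (anyᶠ (λ x → not (f x)))
allᶠ-via-anyᶠ {zero}  f = refl
allᶠ-via-anyᶠ {suc n} f with f zero
... | true  = allᶠ-via-anyᶠ (λ i → f (suc i))
... | false = refl

allᶠ-match : ∀ {n m} (f : Fin n → Bool) (g : Fin m → Bool) →
             (∀ x → Σ (Fin m) λ y → f x ≡ g y) → (∀ y → Σ (Fin n) λ x → g y ≡ f x) →
             allᶠ f ≡ allᶠ g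
allᶠ-match f g forth back = begin
  allᶠ f                        ≡⟨ allᶠ-via-anyᶠ f ⟩
  not (anyᶠ (λ x → not (f x)))  ≡⟨ cong not (anyᶠ-match _ _ (negate forth) (negate back)) ⟩
  not (anyᶠ (λ y → not (g y)))  ≡⟨ sym (allᶠ-via-anyᶠ g) ⟩
  allᶠ g                        ∎
  where
  open ≡-Reasoning
  negate : ∀ {A B : Set} {h : A → Bool} {k : B → Bool} →
           (∀ x → Σ B λ y → h x ≡ k y) → ∀ x → Σ B λ y → not (h x) ≡ not (k y)
  negate match x = let (y , e) = match x in y , cong not e

-- a threshold large enough for φ: atoms need 1, each quantifier doubles
weight : ∀ {k a v} → Formula k a v → ℕ
weight tt        = 1
weight ff        = 1
weight (s ≐ t)   = 1
weight (s ≺ t)   = 1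
weight (rel σ t) = 1
weight (aux j)   = 1
weight (¬' φ)    = weight φ
weight (φ ∧' ψ)  = weight φ + weight ψ
weight (φ ∨' ψ)  = weight φ + weight ψ
weight (∃' φ)    = weight φ + weight φ
weight (∀' φ)    = weight φ + weight φ

-- atoms already need threshold 1 (to tell x = y apart from x < y)
weight-pos : ∀ {k a v} (φ : Formula k a v) → 1 ≤ weight φ
weight-pos tt        = ≤-refl
weight-pos ff        = ≤-refl
weight-pos (s ≐ t)   = ≤-refl
weight-pos (s ≺ t)   = ≤-refl
weight-pos (rel σ t) = ≤-refl
weight-pos (aux j)   = ≤-refl
weight-pos (¬' φ)    = weight-pos φ
weight-pos (φ ∧' ψ)  = ≤-trans (weight-pos φ) (m≤m+n _ _)
weight-pos (φ ∨' ψ)  = ≤-trans (weight-pos φ) (m≤m+n _ _)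
weight-pos (∃' φ)    = ≤-trans (weight-pos φ) (m≤m+n _ _)
weight-pos (∀' φ)    = ≤-trans (weight-pos φ) (m≤m+n _ _)

uniform : ∀ {k N} → (Fin k → Bool) → DB k N
uniform c σ _ = c σ

module _ {k a} (c : Fin k → Bool) (A : Fin a → Bool) where

  eval-similar : ∀ {v N N'} (φ : Formula k a v) {T}
                 {ρ : Fin v → Fin (suc N)} {ρ' : Fin v → Fin (suc N')} →
                 weight φ ≤ T → Sim T ρ ρ' → eval φ (uniform c) A ρ ≡ eval φ (uniform c) A ρ'

  respond : ∀ {v N N'} (φ : Formula k a (suc v))
            {ρ : Fin v → Fin (suc N)} {ρ' : Fin v → Fin (suc N')} →
            Sim (weight φ + weight φ) ρ ρ' → ∀ x →
            Σ (Fin (suc N')) λ x' → eval φ (uniform c) A (x ▷ ρ) ≡ eval φ (uniform c) A (x' ▷ ρ')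
  respond φ H x = let (x' , H') = Extension.extend (weight-pos φ) H x in
                  x' , eval-similar φ ≤-refl H'

  eval-similar tt        le H = refl
  eval-similar ff        le H = refl
  eval-similar (s ≐ t) {ρ = ρ} {ρ'} 1≤T H = does-⇔
    (mk⇔ (λ e → toℕ-injective (Similar-≡ 1≤T (H s t) (cong toℕ e)))
         (λ e → toℕ-injective (Similar-≡ 1≤T (Similar-sym (H s t)) (cong toℕ e))))
    (evalT ρ s ≟ evalT ρ t) (evalT ρ' s ≟ evalT ρ' t)
  eval-similar (s ≺ t) {ρ = ρ} {ρ'} 1≤T H = does-⇔
    (mk⇔ (Similar-< 1≤T (H s t)) (Similar-< 1≤T (Similar-sym (H s t))))
    (evalT ρ s <? evalT ρ t) (evalT ρ' s <? evalT ρ' t)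
  eval-similar (rel σ t) le H = refl
  eval-similar (aux j)   le H = refl
  eval-similar (¬' φ)    le H = cong not (eval-similar φ le H)
  eval-similar (φ ∧' ψ)  le H = cong₂ _∧_ (eval-similar φ (≤-trans (m≤m+n _ _) le) H)
                                          (eval-similar ψ (≤-trans (m≤n+m _ _) le) H)
  eval-similar (φ ∨' ψ)  le H = cong₂ _∨_ (eval-similar φ (≤-trans (m≤m+n _ _) le) H)
                                          (eval-similar ψ (≤-trans (m≤n+m _ _) le) H)
  eval-similar (∃' φ)    le H = anyᶠ-match _ _ (respond φ (Sim-weaken le H))
                                               (respond φ (Sim-sym (Sim-weaken le H)))
  eval-similar (∀' φ)    le H = allᶠ-match _ _ (respond φ (Sim-weaken le H))
                                               (respond φ (Sim-sym (Sim-weaken le H)))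

  sentence-size-invariant : ∀ {N} (φ : Formula k a 0)
                            (ρ : Fin 0 → Fin (suc N)) (ρ' : Fin 0 → Fin (suc (suc N))) →
                            weight φ ≤ N → eval φ (uniform c) A ρ ≡ eval φ (uniform c) A ρ'
  sentence-size-invariant φ ρ ρ' w≤N =
    eval-similar φ ≤-refl (Sim-closed ρ ρ' w≤N (≤-trans w≤N (n≤1+n _)))

-- §6  The lower bound

fillAll : RQ Σ₁
fillAll = record { arity = 0 ; rules = λ _ → just tt }

fillAll-preserving : Preserving fillAll
fillAll-preserving N db ā _ = unary-valid _

noParams : ∀ {N} → Fin 0 → Fin (suc N)
noParams ()

module _ {a} (P : DynProg Σ₁ a (ΔΣ∪ fillAll)) (maintains : Maintains P Lang) where

  -- the update formula of Q under ρ: a sentence over the bare order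
  -- (the old database is empty and all bits are false)
  Q-after-fill : ∀ N → Bool
  Q-after-fill N = eval (DynProg.update P (inj₂ tt) (DynProg.Q P))
                        (uniform {N = N} (λ _ → false)) (λ _ → false) noParams

  -- ρ turns the empty string into a^(n+1), so Q must become its parity
  Q-after-fill-parity : ∀ N → Q-after-fill N ≡ parity {suc N} (λ _ → true)
  Q-after-fill-parity N =
    ⇔→≡ (mk⇔ (λ e → trans (sym (oddLength-word filled)) (Equivalence.to fill e))
             (λ e → Equivalence.from fill (trans (oddLength-word filled) e)))
    where
    filled : DB Σ₁ N
    filled = applyRQ fillAll noParams (λ _ _ → false)
    fill = maintains N (inj₂ tt , noParams) [] (unary-valid _ , tt)

  -- but that sentence has the same value on sizes w + 1 and w + 2, whose
  -- parities differ (parity of a^(w+2) is by definition not parity of a^(w+1))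
  no-parity-program : ⊥
  no-parity-program = not-¬ (Q-after-fill-parity w)
    (trans (sentence-size-invariant (λ _ → false) (λ _ → false) φ noParams noParams ≤-refl)
           (Q-after-fill-parity (suc w)))
    where
    φ = DynProg.update P (inj₂ tt) (DynProg.Q P)
    w = weight φ

theorem13 : ∃[ k ] Σ (List (Fin k) → Set) (λ L → IsRegular L ×
              Σ (RQ k) (λ ρ → Preserving ρ ×
                (DynFO⁰ L ΔΣ × ¬ DynFO⁰ L (ΔΣ∪ ρ))))
theorem13 = Σ₁ , Lang , Lang-regular , fillAll , fillAll-preserving ,
            (1 , parityProgram , parityProgram-maintains) ,
            λ (_ , P , maintains) → no-parity-program P maintains
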